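{- Let $k\ge1$, $1\le r\le4k^2$, and let $(\lambda_1,\lambda_2,\lambda_3,\lambda_4)$ be a board partition with nonnegative integers $\lambda_i\le k^2$ summing to $r$ and satisfying: $\lambda_1\ge\lambda_i$ for all $i>1$; $\lambda_2\ge\lambda_4$; and if $\lambda_1=\lambda_2$ then $\lambda_3\ge\lambda_4$. Let $K\le D_4$ be the subgroup of symmetries preserving the set of boards in $\mathcal{B}(2k,2k;r)$ with this board partition. Then: if $\lambda_1=\lambda_2=\lambda_3=\lambda_4$, $K=D_4$ and $[D_4:K]=1$; if $\lambda_1=\lambda_3>\lambda_2=\lambda_4$, $K=\langle D,D'\rangle$ and $[D_4:K]=2$; if $\lambda_1=\lambda_2>\lambda_3=\lambda_4$, $K=\langle V\rangle$ and $[D_4:K]=4$; if $\lambda_1=\lambda_3$ and $\lambda_2\ne\lambda_4$, $K=\langle D'\rangle$ and $[D_4:K]=4$; if $\lambda_2=\lambda_4$ and $\lambda_1\ne\lambda_3$, $K=\langle D\rangle$ and $[D_4:K]=4$; in all other cases $K$ is trivial and $[D_4:K]=8$.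
   Context: $\mathcal{B}(2k,2k;r)$ is the set of $2k\times 2k$ grids (rows $i$ from top, columns $j$ from left, $1\le i,j\le 2k$) with exactly $r$ blocked cells. $D_4$ acts on boards by the rotations $R_0,R_{90},R_{180},R_{270}$ about the center, reflections $H$ and $V$ across the horizontal and vertical midlines, $D$ across the main diagonal (top-left to bottom-right) and $D'$ across the other diagonal. The board partition $(\lambda_1,\lambda_2,\lambda_3,\lambda_4)$ of a board counts blocked cells in the upper-left (rows $1..k$, columns $1..k$), upper-right (rows $1..k$, columns $k+1..2k$), lower-right (rows $k+1..2k$, columns $k+1..2k$) and lower-left (rows $k+1..2k$, columns $1..k$) quadrants. A symmetry preserves a set of boards if it maps that set onto itself. -}

module Defs where

open import Data.Bool using (Bool; true; false; _∧_; _xor_; if_then_else_; not)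
open import Data.Nat using (ℕ; zero; suc; _+_; _*_; _<ᵇ_; _≤_; _<_)
open import Data.Fin using (Fin; toℕ; opposite)
open import Data.List using (List; []; _∷_; map; allFin; length)
open import Data.Nat.ListAction using (sum)
open import Data.List.Membership.Propositional using (_∈_)
open import Data.List.Relation.Unary.Unique.Propositional using (Unique)
open import Data.Product using (_×_; _,_; Σ; ∃-syntax)
open import Relation.Binary.PropositionalEquality using (_≡_)
open import Function.Bundles using (_⇔_)

data D4 : Set where
  R0 R90 R180 R270 H V D D' : D4

-- Every element of D4 acting on cells (i , j) is: optionally swap the two
-- coordinates, then optionally reverse the row index, then optionally
-- reverse the column index.  enc g = (swap , flipRow , flipCol).
enc : D4 → Bool × Bool × Bool
enc R0   = false , false , false
enc R90  = true  , false , true    -- (i , j) ↦ (j , opp i)   clockwise quarter turn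
enc R180 = false , true  , true
enc R270 = true  , true  , false
enc H    = false , true  , false   -- (i , j) ↦ (opp i , j)   horizontal midline
enc V    = false , false , true    -- (i , j) ↦ (i , opp j)   vertical midline
enc D    = true  , false , false   -- (i , j) ↦ (j , i)       main diagonal
enc D'   = true  , true  , true    -- (i , j) ↦ (opp j , opp i) anti-diagonal

dec : Bool × Bool × Bool → D4
dec (false , false , false) = R0
dec (true  , false , true ) = R90
dec (false , true  , true ) = R180
dec (true  , true  , false) = R270
dec (false , true  , false) = H
dec (false , false , true ) = V
dec (true  , false , false) = D
dec (true  , true  , true ) = D'

-- group law: g ∙ h = "first h, then g"
_∙_ : D4 → D4 → D4
g ∙ h with enc g | enc h
... | (s' , a' , b') | (s , a , b) =
  dec (s xor s' , (if s' then a' xor b else a' xor a) , (if s' then b' xor a else b' xor b))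

inv : D4 → D4
inv R90  = R270
inv R270 = R90
inv g    = g

-- Cells of the 2k × 2k grid: (row , column), rows/columns indexed 0 .. 2k-1
Cell : ℕ → Set
Cell k = Fin (k + k) × Fin (k + k)

flipIf : ∀ {n} → Bool → Fin n → Fin n
flipIf true  i = opposite i
flipIf false i = i

act : ∀ {k} → D4 → Cell k → Cell k
act g (i , j) with enc g
... | (s , a , b) with s
...   | true  = flipIf a j , flipIf b i
...   | false = flipIf a i , flipIf b j

-- A board: which cells are blocked.
Board : ℕ → Set
Board k = Fin (k + k) → Fin (k + k) → Bool

actB : ∀ {k} → D4 → Board k → Board k
actB {k} g B i j with act {k} (inv g) (i , j)
... | (i' , j') = B i' j'

_≈B_ : ∀ {k} → Board k → Board k → Set
B ≈B B' = ∀ i j → B i j ≡ B' i j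

countIn : ∀ k → (Fin (k + k) → Fin (k + k) → Bool) → Board k → ℕ
countIn k P B =
  sum (map (λ i → sum (map (λ j → if B i j ∧ P i j then 1 else 0) (allFin (k + k)))) (allFin (k + k)))

top left : ∀ k → Fin (k + k) → Bool
top k i = toℕ i <ᵇ k
left k j = toℕ j <ᵇ k

blocked : ∀ k → Board k → ℕ
blocked k = countIn k (λ _ _ → true)

-- board partition (λ1 , λ2 , λ3 , λ4): UL, UR, LR, LL
partition : ∀ k → Board k → ℕ × ℕ × ℕ × ℕ
partition k B =
  countIn k (λ i j → top k i ∧ left k j) B ,
  countIn k (λ i j → top k i ∧ not (left k j)) B ,
  countIn k (λ i j → not (top k i) ∧ not (left k j)) B ,
  countIn k (λ i j → not (top k i) ∧ left k j) B

InClass : ∀ k → ℕ → ℕ × ℕ × ℕ × ℕ → Board k → Set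
InClass k r p B = (blocked k B ≡ r) × (partition k B ≡ p)

Preserves : ∀ k → ℕ → ℕ × ℕ × ℕ × ℕ → D4 → Set
Preserves k r p g =
  (∀ B → InClass k r p B → InClass k r p (actB {k} g B)) ×
  (∀ B' → InClass k r p B' → Σ (Board k) λ B → InClass k r p B × (_≈B_ {k} (actB {k} g B) B'))

-- subgroup of D4 generated by a list of elements (in a finite group,
-- closure under identity and products gives the generated subgroup)
data ⟨_⟩ (gs : List D4) : D4 → Set where
  gen : ∀ {g} → g ∈ gs → ⟨ gs ⟩ g
  one : ⟨ gs ⟩ R0
  mul : ∀ {g h} → ⟨ gs ⟩ g → ⟨ gs ⟩ h → ⟨ gs ⟩ (g ∙ h)

_≐_ : (D4 → Set) → (D4 → Set) → Set
K ≐ L = ∀ g → K g ⇔ L g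

HasIndex : (D4 → Set) → ℕ → Set
HasIndex K m = ∃[ ks ] (Unique ks × (∀ g → K g ⇔ g ∈ ks) × (8 ≡ m * length ks))

-- D4 acts on boards, and the board partition of g·B arises from that of B by letting g permute
-- the four quadrant counts (g ⊙ λ), while the number of blocked cells is unchanged. Hence g
-- preserves the class of λ if and only if g ⊙ λ = λ; the "only if" direction needs a board in
-- the class, obtained by filling each quadrant row by row, which is where λᵢ ≤ k² enters.
-- It remains to compute the stabiliser of λ under this permutation action.
module Submission where

open import Data.Bool using (Bool; true; false; not; _∧_; if_then_else_)
open import Data.Bool.Properties
  using (∧-identityʳ; ∧-zeroʳ; ∧-comm; not-involutive; T-≡; ¬-not) renaming (_≟_ to _≟ᵇ_)
open import Data.Empty using (⊥; ⊥-elim)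
open import Data.Fin using (Fin; toℕ; opposite; _↑ˡ_; _↑ʳ_; combine; splitAt)
  renaming (zero to fzero; suc to fsuc)
open import Data.Fin.Permutation using (reverse)
open import Data.Fin.Properties
  using (opposite-prop; opposite-involutive; toℕ<n; toℕ-↑ˡ; toℕ-↑ʳ; splitAt-↑ˡ; splitAt-↑ʳ)
open import Data.List using (List; []; _∷_; map; allFin; tabulate; length)
open import Data.List.Membership.Propositional using (_∈_)
open import Data.List.Properties using (map-tabulate)
open import Data.List.Relation.Unary.All using (All; []; _∷_; all?)
import Data.List.Relation.Unary.All as All
open import Data.List.Relation.Unary.Any using (here; there)
open import Data.Nat using (ℕ; zero; suc; _+_; _*_; _<ᵇ_; _≤_; _<_; _≥_; s≤s)
  renaming (_≟_ to _≟ℕ_)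
open import Data.Nat.ListAction using () renaming (sum to listSum)
open import Data.Nat.Properties
  using (+-0-commutativeMonoid; +-assoc; +-identityʳ; <-irrefl; +-mono-≤; +-mono-≤-<; ≮⇒≥; ≤⇒≯;
         m∸n+n≡m; m≤m+n; <⇒<ᵇ; <ᵇ⇒<; <ᵇ-reflects-<; ≤-antisym; ≤∧≢⇒<)
open import Data.Nat.Tactic.RingSolver using (solve-∀)
open import Data.Product using (_×_; _,_; proj₂; uncurry; ∃)
import Data.Product as Product
open import Data.Product.Properties using (≡-dec)
open import Data.Sum using ([_,_]′)
open import Data.Unit using (⊤; tt)
open import Defs
open import Function using (id; _∘_; Equivalence; _⇔_; mk⇔)
import Function.Properties.Equivalence as ⇔
open import Relation.Binary.Definitions using (DecidableEquality)
open import Relation.Binary.PropositionalEquality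
open import Relation.Nullary using (¬_; Dec; yes; no)
open import Relation.Nullary.Decidable using (True; toWitness; map′)
open import Relation.Nullary.Reflects using (ofʸ; ofⁿ)
open import Algebra.Properties.CommutativeMonoid.Sum +-0-commutativeMonoid
  using (sum-syntax; sum-cong-≗; sum-replicate-zero; ∑-comm; ∑-distrib-+; ∑-permute)

indicator : Bool → ℕ
indicator b = if b then 1 else 0

listSum-tabulate : ∀ n (f : Fin n → ℕ) → listSum (tabulate f) ≡ ∑[ i < n ] f i
listSum-tabulate zero    f = refl
listSum-tabulate (suc n) f = cong (f fzero +_) (listSum-tabulate n (f ∘ fsuc))

listSum-allFin : ∀ n (f : Fin n → ℕ) → listSum (map f (allFin n)) ≡ ∑[ i < n ] f i
listSum-allFin n f = trans (cong listSum (map-tabulate id f)) (listSum-tabulate n f)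

∑-opposite : ∀ n (f : Fin n → ℕ) → ∑[ i < n ] f (opposite i) ≡ ∑[ i < n ] f i
∑-opposite n f = sym (∑-permute f reverse)

∑-↑ : ∀ m {n} (f : Fin (m + n) → ℕ) →
      ∑[ i < m + n ] f i ≡ ∑[ i < m ] f (i ↑ˡ n) + ∑[ j < n ] f (m ↑ʳ j)
∑-↑ zero    f = refl
∑-↑ (suc m) f = trans (cong (f fzero +_) (∑-↑ m (f ∘ fsuc))) (sym (+-assoc (f fzero) _ _))

∑-combine : ∀ m n (f : Fin (m * n) → ℕ) →
            ∑[ i < m ] ∑[ j < n ] f (combine i j) ≡ ∑[ z < m * n ] f z
∑-combine zero    n f = refl
∑-combine (suc m) n f =
  trans (cong (∑[ j < n ] f (j ↑ˡ m * n) +_) (∑-combine m n (f ∘ (n ↑ʳ_))))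
        (sym (∑-↑ n f))

∑-<ᵇ : ∀ n l → l ≤ n → ∑[ z < n ] indicator (toℕ z <ᵇ l) ≡ l
∑-<ᵇ n       zero    _         = sum-replicate-zero n
∑-<ᵇ (suc n) (suc l) (s≤s l≤n) = cong suc (∑-<ᵇ n l l≤n)

∑² : ∀ n → (Fin n × Fin n → ℕ) → ℕ
∑² n F = ∑[ i < n ] ∑[ j < n ] F (i , j)


flipWhen : ∀ {X : Set} → (X → X) → Bool → X → X
flipWhen φ true  = φ
flipWhen φ false = id

actOn : ∀ {X : Set} → (X → X) → D4 → X × X → X × X
actOn φ g (x , y) with enc g
... | true  , a , b = flipWhen φ a y , flipWhen φ b x
... | false , a , b = flipWhen φ a x , flipWhen φ b y

actOn-inv : ∀ {X : Set} {φ : X → X} → (∀ x → φ (φ x) ≡ x) →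
            ∀ g c → actOn φ (inv g) (actOn φ g c) ≡ c
actOn-inv invol R0   (x , y) = refl
actOn-inv invol R90  (x , y) = cong (_, y) (invol x)
actOn-inv invol R180 (x , y) = cong₂ _,_ (invol x) (invol y)
actOn-inv invol R270 (x , y) = cong (x ,_) (invol y)
actOn-inv invol H    (x , y) = cong (_, y) (invol x)
actOn-inv invol V    (x , y) = cong (x ,_) (invol y)
actOn-inv invol D    (x , y) = refl
actOn-inv invol D'   (x , y) = cong₂ _,_ (invol x) (invol y)

flipWhen-natural : ∀ {X Y : Set} {φ : X → X} {ψ : Y → Y} (f : X → Y) →
                   (∀ x → f (φ x) ≡ ψ (f x)) →
                   ∀ a x → f (flipWhen φ a x) ≡ flipWhen ψ a (f x)
flipWhen-natural f f∘φ≗ψ∘f true  x = f∘φ≗ψ∘f x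
flipWhen-natural f f∘φ≗ψ∘f false x = refl

actOn-natural : ∀ {X Y : Set} {φ : X → X} {ψ : Y → Y} (f : X → Y) →
                (∀ x → f (φ x) ≡ ψ (f x)) →
                ∀ g c → Product.map f f (actOn φ g c) ≡ actOn ψ g (Product.map f f c)
actOn-natural f nat g (x , y) with enc g
... | true  , a , b = cong₂ _,_ (flipWhen-natural f nat a y) (flipWhen-natural f nat b x)
... | false , a , b = cong₂ _,_ (flipWhen-natural f nat a x) (flipWhen-natural f nat b y)

act-actOn : ∀ k g (c : Cell k) → act {k} g c ≡ actOn opposite g c
act-actOn k R0   (i , j) = refl
act-actOn k R90  (i , j) = refl
act-actOn k R180 (i , j) = refl
act-actOn k R270 (i , j) = refl
act-actOn k H    (i , j) = refl
act-actOn k V    (i , j) = refl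
act-actOn k D    (i , j) = refl
act-actOn k D'   (i , j) = refl

act-inv : ∀ k g (c : Cell k) → act {k} (inv g) (act {k} g c) ≡ c
act-inv k g c = begin
  act {k} (inv g) (act {k} g c)               ≡⟨ act-actOn k (inv g) (act {k} g c) ⟩
  actOn opposite (inv g) (act {k} g c)        ≡⟨ cong (actOn opposite (inv g)) (act-actOn k g c) ⟩
  actOn opposite (inv g) (actOn opposite g c) ≡⟨ actOn-inv opposite-involutive g c ⟩
  c                                           ∎
  where open ≡-Reasoning

∑-flipWhen : ∀ {n} a (f : Fin n → ℕ) → ∑[ i < n ] f (flipWhen opposite a i) ≡ ∑[ i < n ] f i
∑-flipWhen true  f = ∑-opposite _ f
∑-flipWhen false f = refl

∑²-actOn : ∀ n g (F : Fin n × Fin n → ℕ) → ∑² n (F ∘ actOn opposite g) ≡ ∑² n F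
∑²-actOn n g F with enc g
... | true  , a , b = begin
  ∑[ i < n ] ∑[ j < n ] F (flipWhen opposite a j , flipWhen opposite b i)
    ≡⟨ ∑-comm (λ i j → F (flipWhen opposite a j , flipWhen opposite b i)) ⟩
  ∑[ j < n ] ∑[ i < n ] F (flipWhen opposite a j , flipWhen opposite b i)
    ≡⟨ sum-cong-≗ (λ j → ∑-flipWhen b (λ i → F (flipWhen opposite a j , i))) ⟩
  ∑[ j < n ] ∑[ i < n ] F (flipWhen opposite a j , i)
    ≡⟨ ∑-flipWhen a (λ j → ∑[ i < n ] F (j , i)) ⟩
  ∑² n F                                                                  ∎
  where open ≡-Reasoning
... | false , a , b =
  trans (sum-cong-≗ (λ i → ∑-flipWhen b (λ j → F (flipWhen opposite a i , j))))
        (∑-flipWhen a (λ i → ∑[ j < n ] F (i , j)))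

∑²-act : ∀ k g (F : Cell k → ℕ) → ∑² (k + k) (F ∘ act {k} g) ≡ ∑² (k + k) F
∑²-act k g F = trans (sum-cong-≗ (λ i → sum-cong-≗ (λ j → cong F (act-actOn k g (i , j)))))
                     (∑²-actOn (k + k) g F)


countIn-∑² : ∀ k P (B : Board k) →
             countIn k P B ≡ ∑² (k + k) (λ (i , j) → indicator (B i j ∧ P i j))
countIn-∑² k P B =
  trans (listSum-allFin (k + k) _)
        (sum-cong-≗ (λ i → listSum-allFin (k + k) (λ j → indicator (B i j ∧ P i j))))

countIn-cong : ∀ k {P P'} (B : Board k) → (∀ i j → P i j ≡ P' i j) →
               countIn k P B ≡ countIn k P' B
countIn-cong k {P} {P'} B P≗P' = begin
  countIn k P B                                            ≡⟨ countIn-∑² k P B ⟩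
  ∑² (k + k) (λ (i , j) → indicator (B i j ∧ P i j))
    ≡⟨ sum-cong-≗ (λ i → sum-cong-≗ (λ j → cong (λ b → indicator (B i j ∧ b)) (P≗P' i j))) ⟩
  ∑² (k + k) (λ (i , j) → indicator (B i j ∧ P' i j))     ≡⟨ countIn-∑² k P' B ⟨
  countIn k P' B                                           ∎
  where open ≡-Reasoning

countIn-actB : ∀ k g P (B : Board k) →
               countIn k P (actB {k} g B) ≡ countIn k (λ i j → uncurry P (act {k} g (i , j))) B
countIn-actB k g P B = begin
  countIn k P (actB {k} g B)       ≡⟨ countIn-∑² k P (actB {k} g B) ⟩
  ∑² (k + k) F                     ≡⟨ ∑²-act k g F ⟨
  ∑² (k + k) (F ∘ act {k} g)
    ≡⟨ sum-cong-≗ (λ i → sum-cong-≗ (λ j →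
         cong (λ c → indicator (uncurry B c ∧ uncurry P (act {k} g (i , j)))) (act-inv k g (i , j)))) ⟩
  ∑² (k + k) (λ (i , j) → indicator (B i j ∧ uncurry P (act {k} g (i , j))))
                                   ≡⟨ countIn-∑² k _ B ⟨
  countIn k (λ i j → uncurry P (act {k} g (i , j))) B ∎
  where
  open ≡-Reasoning
  F : Cell k → ℕ
  F (i , j) = indicator (actB {k} g B i j ∧ P i j)


<ᵇ-true : ∀ {m n} → m < n → (m <ᵇ n) ≡ true
<ᵇ-true m<n = Equivalence.to T-≡ (<⇒<ᵇ m<n)

<ᵇ-false : ∀ {m n} → n ≤ m → (m <ᵇ n) ≡ false
<ᵇ-false {m} {n} n≤m = ¬-not (λ m<ᵇn → ≤⇒≯ n≤m (<ᵇ⇒< m n (Equivalence.from T-≡ m<ᵇn)))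

<ᵇ-mirror : ∀ {k x y} → y + suc x ≡ k + k → (y <ᵇ k) ≡ not (x <ᵇ k)
<ᵇ-mirror {k} {x} {y} e with x <ᵇ k | <ᵇ-reflects-< x k | y <ᵇ k | <ᵇ-reflects-< y k
... | true  | ofʸ x<k | true  | ofʸ y<k = ⊥-elim (<-irrefl e (+-mono-≤ y<k x<k))
... | true  | _       | false | _       = refl
... | false | _       | true  | _       = refl
... | false | ofⁿ x≮k | false | ofⁿ y≮k =
  ⊥-elim (<-irrefl (sym e) (+-mono-≤-< (≮⇒≥ y≮k) (s≤s (≮⇒≥ x≮k))))

Quadrant : Set
Quadrant = Bool × Bool

quadrant : ∀ k → Cell k → Quadrant
quadrant k (i , j) = top k i , left k j

top-opposite : ∀ k (i : Fin (k + k)) → top k (opposite i) ≡ not (top k i)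
top-opposite k i =
  <ᵇ-mirror {k} (trans (cong (_+ suc (toℕ i)) (opposite-prop i)) (m∸n+n≡m (toℕ<n i)))

quadrant-act : ∀ k g (c : Cell k) → quadrant k (act {k} g c) ≡ actOn not g (quadrant k c)
quadrant-act k g c =
  trans (cong (quadrant k) (act-actOn k g c)) (actOn-natural (top k) (top-opposite k) g c)

countRegion : ∀ k → (Quadrant → Bool) → Board k → ℕ
countRegion k R = countIn k (λ i j → R (quadrant k (i , j)))

countRegion-cong : ∀ k {R R'} (B : Board k) → (∀ q → R q ≡ R' q) →
                   countRegion k R B ≡ countRegion k R' B
countRegion-cong k B R≗R' = countIn-cong k B (λ i j → R≗R' _)

countRegion-actB : ∀ k g R (B : Board k) →
                   countRegion k R (actB {k} g B) ≡ countRegion k (R ∘ actOn not g) B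
countRegion-actB k g R B =
  trans (countIn-actB k g _ B) (countIn-cong k B (λ i j → cong R (quadrant-act k g (i , j))))

blocked-actB : ∀ k g (B : Board k) → blocked k (actB {k} g B) ≡ blocked k B
blocked-actB k g = countRegion-actB k g (λ _ → true)

-- Chosen so that (q ==Q_) ∘ quadrant k unfolds to the quadrant predicates used by partition:
-- partition k B is tabulateQ (λ q → countRegion k (q ==Q_) B) by definition.
_==_ : Bool → Bool → Bool
true  == x = x
false == x = not x

_==Q_ : Quadrant → Quadrant → Bool
(a , b) ==Q (x , y) = (a == x) ∧ (b == y)

==-flipWhen : ∀ c a x → (flipWhen not c a == flipWhen not c x) ≡ (a == x)
==-flipWhen false a     x = refl
==-flipWhen true  true  x = not-involutive x
==-flipWhen true  false x = refl

==Q-actOn : ∀ g q x → (actOn not g q ==Q actOn not g x) ≡ (q ==Q x)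
==Q-actOn g (a , b) (x , y) with enc g
... | true  , c , d =
  trans (cong₂ _∧_ (==-flipWhen c b y) (==-flipWhen d a x)) (∧-comm (b == y) (a == x))
... | false , c , d = cong₂ _∧_ (==-flipWhen c a x) (==-flipWhen d b y)

==Q-transpose : ∀ g q x → (q ==Q actOn not g x) ≡ (actOn not (inv g) q ==Q x)
==Q-transpose g q x = begin
  q ==Q actOn not g x                                       ≡⟨ ==Q-actOn (inv g) q (actOn not g x) ⟨
  actOn not (inv g) q ==Q actOn not (inv g) (actOn not g x)
    ≡⟨ cong (actOn not (inv g) q ==Q_) (actOn-inv not-involutive g x) ⟩
  actOn not (inv g) q ==Q x                                 ∎
  where open ≡-Reasoning

_at_ : ℕ × ℕ × ℕ × ℕ → Quadrant → ℕ
(l , _ , _ , _) at (true  , true ) = l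
(_ , l , _ , _) at (true  , false) = l
(_ , _ , l , _) at (false , false) = l
(_ , _ , _ , l) at (false , true ) = l

tabulateQ : (Quadrant → ℕ) → ℕ × ℕ × ℕ × ℕ
tabulateQ f = f (true , true) , f (true , false) , f (false , false) , f (false , true)

tabulateQ-at : ∀ f q → tabulateQ f at q ≡ f q
tabulateQ-at f (true  , true ) = refl
tabulateQ-at f (true  , false) = refl
tabulateQ-at f (false , false) = refl
tabulateQ-at f (false , true ) = refl

tabulateQ-cong : ∀ {f f'} → (∀ q → f q ≡ f' q) → tabulateQ f ≡ tabulateQ f'
tabulateQ-cong f≗f' = cong₂ _,_ (f≗f' _) (cong₂ _,_ (f≗f' _) (cong₂ _,_ (f≗f' _) (f≗f' _)))

_⊙_ : D4 → ℕ × ℕ × ℕ × ℕ → ℕ × ℕ × ℕ × ℕ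
g ⊙ p = tabulateQ (λ q → p at actOn not (inv g) q)

⊙-inv : ∀ g p → inv g ⊙ (g ⊙ p) ≡ p
⊙-inv R0   (a , b , c , d) = refl
⊙-inv R90  (a , b , c , d) = refl
⊙-inv R180 (a , b , c , d) = refl
⊙-inv R270 (a , b , c , d) = refl
⊙-inv H    (a , b , c , d) = refl
⊙-inv V    (a , b , c , d) = refl
⊙-inv D    (a , b , c , d) = refl
⊙-inv D'   (a , b , c , d) = refl

partition-actB : ∀ k g (B : Board k) → partition k (actB {k} g B) ≡ g ⊙ partition k B
partition-actB k g B = tabulateQ-cong λ q → begin
  countRegion k (q ==Q_) (actB {k} g B)     ≡⟨ countRegion-actB k g (q ==Q_) B ⟩
  countRegion k ((q ==Q_) ∘ actOn not g) B  ≡⟨ countRegion-cong k B (==Q-transpose g q) ⟩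
  countRegion k (actOn not (inv g) q ==Q_) B
    ≡⟨ tabulateQ-at (λ q' → countRegion k (q' ==Q_) B) (actOn not (inv g) q) ⟨
  partition k B at actOn not (inv g) q      ∎
  where open ≡-Reasoning


half : ∀ k → Bool → Fin k → Fin (k + k)
half k true  x = x ↑ˡ k
half k false x = k ↑ʳ x

top-half : ∀ k u (x : Fin k) → top k (half k u x) ≡ u
top-half k true  x = <ᵇ-true (subst (_< k) (sym (toℕ-↑ˡ x k)) (toℕ<n x))
top-half k false x = <ᵇ-false (subst (k ≤_) (sym (toℕ-↑ʳ k x)) (m≤m+n k (toℕ x)))

offset : ∀ k → Fin (k + k) → Fin k
offset k i = [ id , id ]′ (splitAt k i)

offset-half : ∀ k u (x : Fin k) → offset k (half k u x) ≡ x
offset-half k true  x = cong [ id , id ]′ (splitAt-↑ˡ k x k)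
offset-half k false x = cong [ id , id ]′ (splitAt-↑ʳ k k x)

∑Q : (Quadrant → ℕ) → ℕ
∑Q f = (f (true , true) + f (false , true)) + (f (true , false) + f (false , false))

∑Q-cong : ∀ {f f'} → (∀ q → f q ≡ f' q) → ∑Q f ≡ ∑Q f'
∑Q-cong f≗f' = cong₂ _+_ (cong₂ _+_ (f≗f' _) (f≗f' _)) (cong₂ _+_ (f≗f' _) (f≗f' _))

∑²-quadrants : ∀ k (F : Cell k → ℕ) →
               ∑² (k + k) F ≡ ∑Q (λ (u , v) → ∑[ x < k ] ∑[ y < k ] F (half k u x , half k v y))
∑²-quadrants k F = begin
  ∑² (k + k) F
    ≡⟨ sum-cong-≗ (λ i → ∑-↑ k (λ j → F (i , j))) ⟩
  ∑[ i < k + k ] (∑[ y < k ] F (i , half k true y) + ∑[ y < k ] F (i , half k false y))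
    ≡⟨ ∑-distrib-+ (λ i → ∑[ y < k ] F (i , half k true y))
                   (λ i → ∑[ y < k ] F (i , half k false y)) ⟩
  ∑[ i < k + k ] ∑[ y < k ] F (i , half k true y) + ∑[ i < k + k ] ∑[ y < k ] F (i , half k false y)
    ≡⟨ cong₂ _+_ (∑-↑ k (λ i → ∑[ y < k ] F (i , half k true y)))
                 (∑-↑ k (λ i → ∑[ y < k ] F (i , half k false y))) ⟩
  ∑Q (λ (u , v) → ∑[ x < k ] ∑[ y < k ] F (half k u x , half k v y)) ∎
  where open ≡-Reasoning

fillBoard : ∀ k → ℕ × ℕ × ℕ × ℕ → Board k
fillBoard k p i j = toℕ (combine (offset k i) (offset k j)) <ᵇ p at quadrant k (i , j)

∑-block : ∀ k l b → l ≤ k * k →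
          ∑[ x < k ] ∑[ y < k ] indicator ((toℕ (combine x y) <ᵇ l) ∧ b) ≡ (if b then l else 0)
∑-block k l true l≤k*k =
  trans (sum-cong-≗ {k} (λ x → sum-cong-≗ {k} (λ y →
           cong indicator (∧-identityʳ (toℕ (combine x y) <ᵇ l)))))
        (trans (∑-combine k k (λ z → indicator (toℕ z <ᵇ l))) (∑-<ᵇ (k * k) l l≤k*k))
∑-block k l false _ =
  trans (sum-cong-≗ {k} (λ x →
           trans (sum-cong-≗ {k} (λ y → cong indicator (∧-zeroʳ (toℕ (combine x y) <ᵇ l))))
                 (sum-replicate-zero k)))
        (sum-replicate-zero k)

countRegion-fillBoard : ∀ k p R → (∀ q → p at q ≤ k * k) →
                        countRegion k R (fillBoard k p) ≡ ∑Q (λ q → if R q then p at q else 0)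
countRegion-fillBoard k p R p≤k*k = begin
  countRegion k R (fillBoard k p)
    ≡⟨ countIn-∑² k _ (fillBoard k p) ⟩
  ∑² (k + k) (λ c → indicator (uncurry (fillBoard k p) c ∧ R (quadrant k c)))
    ≡⟨ ∑²-quadrants k _ ⟩
  ∑Q (λ (u , v) → ∑[ x < k ] ∑[ y < k ] indicator (fillBoard k p (half k u x) (half k v y)
                                                   ∧ R (quadrant k (half k u x , half k v y))))
    ≡⟨ ∑Q-cong (λ (u , v) → sum-cong-≗ λ x → sum-cong-≗ λ y →
                  cong indicator (fillBoard-half u v x y)) ⟩
  ∑Q (λ q → ∑[ x < k ] ∑[ y < k ] indicator ((toℕ (combine x y) <ᵇ p at q) ∧ R q))
    ≡⟨ ∑Q-cong (λ q → ∑-block k (p at q) (R q) (p≤k*k q)) ⟩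
  ∑Q (λ q → if R q then p at q else 0) ∎
  where
  open ≡-Reasoning
  fillBoard-half : ∀ u v x y →
    (fillBoard k p (half k u x) (half k v y) ∧ R (quadrant k (half k u x , half k v y)))
      ≡ ((toℕ (combine x y) <ᵇ p at (u , v)) ∧ R (u , v))
  fillBoard-half u v x y
    rewrite offset-half k u x | offset-half k v y | top-half k u x | top-half k v y = refl

∑Q-==Q : ∀ p q → ∑Q (λ q' → if q ==Q q' then p at q' else 0) ≡ p at q
∑Q-==Q (a , b , c , d) (true  , true ) = trans (+-identityʳ (a + 0)) (+-identityʳ a)
∑Q-==Q (a , b , c , d) (true  , false) = +-identityʳ b
∑Q-==Q (a , b , c , d) (false , false) = refl
∑Q-==Q (a , b , c , d) (false , true ) = +-identityʳ d

inClass-fillBoard : ∀ k r a b c d → a ≤ k * k → b ≤ k * k → c ≤ k * k → d ≤ k * k →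
                    a + b + c + d ≡ r →
                    InClass k r (a , b , c , d) (fillBoard k (a , b , c , d))
inClass-fillBoard k r a b c d a≤ b≤ c≤ d≤ a+b+c+d≡r =
  trans (countRegion-fillBoard k p (λ _ → true) p≤k*k) (trans (+-shuffle a b c d) a+b+c+d≡r) ,
  tabulateQ-cong (λ q → trans (countRegion-fillBoard k p (q ==Q_) p≤k*k) (∑Q-==Q p q))
  where
  p : ℕ × ℕ × ℕ × ℕ
  p = a , b , c , d
  p≤k*k : ∀ q → p at q ≤ k * k
  p≤k*k (true  , true ) = a≤
  p≤k*k (true  , false) = b≤
  p≤k*k (false , false) = c≤
  p≤k*k (false , true ) = d≤
  +-shuffle : ∀ a b c d → (a + d) + (b + c) ≡ a + b + c + d
  +-shuffle = solve-∀


actB-inClass : ∀ k r p g (B : Board k) → g ⊙ p ≡ p →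
               InClass k r p B → InClass k r p (actB {k} g B)
actB-inClass k r p g B g⊙p≡p (blocked≡r , partition≡p) = trans (blocked-actB k g B) blocked≡r , (begin
  partition k (actB {k} g B) ≡⟨ partition-actB k g B ⟩
  g ⊙ partition k B          ≡⟨ cong (g ⊙_) partition≡p ⟩
  g ⊙ p                      ≡⟨ g⊙p≡p ⟩
  p                          ∎)
  where open ≡-Reasoning

actB-inv : ∀ k g (B : Board k) → _≈B_ {k} (actB {k} g (actB {k} (inv g) B)) B
actB-inv k g B i j = cong (uncurry B) (act-inv k (inv g) (i , j))

preserves⇔fixes : ∀ k r p → ∃ (InClass k r p) → ∀ g → Preserves k r p g ⇔ (g ⊙ p ≡ p)
preserves⇔fixes k r p (B₀ , B₀∈) g = mk⇔ to from
  where
  open ≡-Reasoning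
  to : Preserves k r p g → g ⊙ p ≡ p
  to (maps-into , _) = begin
    g ⊙ p                       ≡⟨ cong (g ⊙_) (proj₂ B₀∈) ⟨
    g ⊙ partition k B₀          ≡⟨ partition-actB k g B₀ ⟨
    partition k (actB {k} g B₀) ≡⟨ proj₂ (maps-into B₀ B₀∈) ⟩
    p                           ∎
  from : g ⊙ p ≡ p → Preserves k r p g
  from g⊙p≡p =
    (λ B → actB-inClass k r p g B g⊙p≡p) ,
    (λ B′ B′∈ → actB {k} (inv g) B′ ,
                actB-inClass k r p (inv g) B′ inv-g⊙p≡p B′∈ ,
                actB-inv k g B′)
    where
    inv-g⊙p≡p : inv g ⊙ p ≡ p
    inv-g⊙p≡p = trans (cong (inv g ⊙_) (sym g⊙p≡p)) (⊙-inv g p)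


dec-enc : ∀ g → dec (enc g) ≡ g
dec-enc R0   = refl
dec-enc R90  = refl
dec-enc R180 = refl
dec-enc R270 = refl
dec-enc H    = refl
dec-enc V    = refl
dec-enc D    = refl
dec-enc D'   = refl

_≟_ : DecidableEquality D4
g ≟ h = map′ (λ e → trans (sym (dec-enc g)) (trans (cong dec e) (dec-enc h))) (cong enc)
             (≡-dec _≟ᵇ_ (≡-dec _≟ᵇ_ _≟ᵇ_) (enc g) (enc h))

open import Data.List.Membership.DecPropositional _≟_ using (_∈?_)
open import Data.List.Relation.Unary.Unique.DecPropositional _≟_ using (unique?)

elements : List D4
elements = R0 ∷ R90 ∷ R180 ∷ R270 ∷ H ∷ V ∷ D ∷ D' ∷ []

∈-elements : ∀ g → g ∈ elements
∈-elements R0   = here refl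
∈-elements R90  = there (here refl)
∈-elements R180 = there (there (here refl))
∈-elements R270 = there (there (there (here refl)))
∈-elements H    = there (there (there (there (here refl))))
∈-elements V    = there (there (there (there (there (here refl)))))
∈-elements D    = there (there (there (there (there (there (here refl))))))
∈-elements D'   = there (there (there (there (there (there (there (here refl)))))))

Closed : List D4 → Set
Closed ks = ∀ {g h} → g ∈ ks → h ∈ ks → g ∙ h ∈ ks

closed? : ∀ ks → Dec (All (λ g → All (λ h → g ∙ h ∈ ks) ks) ks)
closed? ks = all? (λ g → all? (λ h → g ∙ h ∈? ks) ks) ks

⟨⟩⊆ : ∀ {gs ks} → R0 ∈ ks → (∀ {g} → g ∈ gs → g ∈ ks) → Closed ks →
      ∀ {g} → ⟨ gs ⟩ g → g ∈ ks
⟨⟩⊆ R0∈ gs⊆ks closed (gen g∈gs) = gs⊆ks g∈gs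
⟨⟩⊆ R0∈ gs⊆ks closed one        = R0∈
⟨⟩⊆ R0∈ gs⊆ks closed (mul g h)  = closed (⟨⟩⊆ R0∈ gs⊆ks closed g) (⟨⟩⊆ R0∈ gs⊆ks closed h)

⟨⟩⇔∈ : ∀ gs ks {_ : True (R0 ∈? ks)} {_ : True (all? (_∈? ks) gs)} {_ : True (closed? ks)} →
       All ⟨ gs ⟩ ks → ∀ g → ⟨ gs ⟩ g ⇔ g ∈ ks
⟨⟩⇔∈ gs ks {R0∈} {gs⊆ks} {closed} ks⊆⟨gs⟩ g =
  mk⇔ (⟨⟩⊆ (toWitness R0∈) (All.lookup (toWitness gs⊆ks)) closed′) (All.lookup ks⊆⟨gs⟩)
  where
  closed′ : Closed ks
  closed′ g∈ h∈ = All.lookup (All.lookup (toWitness closed) g∈) h∈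

subgroup-index : ∀ {K L : D4 → Set} ks m {_ : True (unique? ks)} →
                 (∀ g → K g ⇔ g ∈ ks) → (∀ g → L g ⇔ g ∈ ks) → 8 ≡ m * length ks →
                 (K ≐ L) × HasIndex K m
subgroup-index ks m {unique} K⇔∈ L⇔∈ 8≡m*|ks| =
  (λ g → ⇔.trans (K⇔∈ g) (⇔.sym (L⇔∈ g))) , ks , toWitness unique , K⇔∈ , 8≡m*|ks|


stabiliser⇔ : ∀ {p} ks → (∀ g → g ⊙ p ≡ p → g ∈ ks) → All (λ g → g ⊙ p ≡ p) ks →
              ∀ g → (g ⊙ p ≡ p) ⇔ g ∈ ks
stabiliser⇔ ks fixes⇒∈ ks-fix g = mk⇔ (fixes⇒∈ g) (All.lookup ks-fix)

at-constant : ∀ a q → (a , a , a , a) at q ≡ a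
at-constant a (true  , true ) = refl
at-constant a (true  , false) = refl
at-constant a (false , false) = refl
at-constant a (false , true ) = refl

fixes-constant : ∀ {a b c d} → a ≡ b → b ≡ c → c ≡ d →
                 ∀ g → g ⊙ (a , b , c , d) ≡ (a , b , c , d)
fixes-constant {a} refl refl refl g = tabulateQ-cong (λ q → at-constant a (actOn not (inv g) q))

-- Matching the fixed-point equation g ⊙ p ≡ p against refl identifies the quadrant counts
-- that g permutes; each non-member of the stabiliser then contradicts the case hypothesis.
stabiliser-⟨D,D'⟩ : ∀ {a b c d} → a ≡ c → b < a → b ≡ d →
                    ∀ g → (g ⊙ (a , b , c , d) ≡ (a , b , c , d)) ⇔ g ∈ R0 ∷ R180 ∷ D ∷ D' ∷ []
stabiliser-⟨D,D'⟩ refl b<a refl = stabiliser⇔ _ (fixes⇒∈ b<a) (refl ∷ refl ∷ refl ∷ refl ∷ [])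
  where
  fixes⇒∈ : ∀ {a b} → b < a →
            ∀ g → g ⊙ (a , b , a , b) ≡ (a , b , a , b) → g ∈ R0 ∷ R180 ∷ D ∷ D' ∷ []
  fixes⇒∈ _   R0   _    = here refl
  fixes⇒∈ _   R180 _    = there (here refl)
  fixes⇒∈ _   D    _    = there (there (here refl))
  fixes⇒∈ _   D'   _    = there (there (there (here refl)))
  fixes⇒∈ b<a R90  refl = ⊥-elim (<-irrefl refl b<a)
  fixes⇒∈ b<a R270 refl = ⊥-elim (<-irrefl refl b<a)
  fixes⇒∈ b<a H    refl = ⊥-elim (<-irrefl refl b<a)
  fixes⇒∈ b<a V    refl = ⊥-elim (<-irrefl refl b<a)

stabiliser-⟨V⟩ : ∀ {a b c d} → a ≡ b → c < a → c ≡ d →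
                 ∀ g → (g ⊙ (a , b , c , d) ≡ (a , b , c , d)) ⇔ g ∈ R0 ∷ V ∷ []
stabiliser-⟨V⟩ refl c<a refl = stabiliser⇔ _ (fixes⇒∈ c<a) (refl ∷ refl ∷ [])
  where
  fixes⇒∈ : ∀ {a c} → c < a → ∀ g → g ⊙ (a , a , c , c) ≡ (a , a , c , c) → g ∈ R0 ∷ V ∷ []
  fixes⇒∈ _   R0   _    = here refl
  fixes⇒∈ _   V    _    = there (here refl)
  fixes⇒∈ c<a R90  refl = ⊥-elim (<-irrefl refl c<a)
  fixes⇒∈ c<a R180 refl = ⊥-elim (<-irrefl refl c<a)
  fixes⇒∈ c<a R270 refl = ⊥-elim (<-irrefl refl c<a)
  fixes⇒∈ c<a H    refl = ⊥-elim (<-irrefl refl c<a)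
  fixes⇒∈ c<a D    refl = ⊥-elim (<-irrefl refl c<a)
  fixes⇒∈ c<a D'   refl = ⊥-elim (<-irrefl refl c<a)

stabiliser-⟨D'⟩ : ∀ {a b c d} → a ≡ c → b ≢ d →
                  ∀ g → (g ⊙ (a , b , c , d) ≡ (a , b , c , d)) ⇔ g ∈ R0 ∷ D' ∷ []
stabiliser-⟨D'⟩ refl b≢d = stabiliser⇔ _ (fixes⇒∈ b≢d) (refl ∷ refl ∷ [])
  where
  fixes⇒∈ : ∀ {a b d} → b ≢ d → ∀ g → g ⊙ (a , b , a , d) ≡ (a , b , a , d) → g ∈ R0 ∷ D' ∷ []
  fixes⇒∈ _   R0   _    = here refl
  fixes⇒∈ _   D'   _    = there (here refl)
  fixes⇒∈ b≢d R90  refl = ⊥-elim (b≢d refl)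
  fixes⇒∈ b≢d R180 refl = ⊥-elim (b≢d refl)
  fixes⇒∈ b≢d R270 refl = ⊥-elim (b≢d refl)
  fixes⇒∈ b≢d H    refl = ⊥-elim (b≢d refl)
  fixes⇒∈ b≢d V    refl = ⊥-elim (b≢d refl)
  fixes⇒∈ b≢d D    refl = ⊥-elim (b≢d refl)

stabiliser-⟨D⟩ : ∀ {a b c d} → b ≡ d → a ≢ c →
                 ∀ g → (g ⊙ (a , b , c , d) ≡ (a , b , c , d)) ⇔ g ∈ R0 ∷ D ∷ []
stabiliser-⟨D⟩ refl a≢c = stabiliser⇔ _ (fixes⇒∈ a≢c) (refl ∷ refl ∷ [])
  where
  fixes⇒∈ : ∀ {a b c} → a ≢ c → ∀ g → g ⊙ (a , b , c , b) ≡ (a , b , c , b) → g ∈ R0 ∷ D ∷ []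
  fixes⇒∈ _   R0   _    = here refl
  fixes⇒∈ _   D    _    = there (here refl)
  fixes⇒∈ a≢c R90  refl = ⊥-elim (a≢c refl)
  fixes⇒∈ a≢c R180 refl = ⊥-elim (a≢c refl)
  fixes⇒∈ a≢c R270 refl = ⊥-elim (a≢c refl)
  fixes⇒∈ a≢c H    refl = ⊥-elim (a≢c refl)
  fixes⇒∈ a≢c V    refl = ⊥-elim (a≢c refl)
  fixes⇒∈ a≢c D'   refl = ⊥-elim (a≢c refl)

balanced-diagonals-excluded : ∀ {a b} → b ≤ a →
  ¬ ((a ≡ b) × (b ≡ a) × (a ≡ b)) → ¬ ((a ≡ a) × (b < a) × (b ≡ b)) → ⊥
balanced-diagonals-excluded {a} {b} b≤a ¬all-equal ¬c2 with a ≟ℕ b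
... | yes refl = ¬all-equal (refl , refl , refl)
... | no  a≢b  = ¬c2 (refl , ≤∧≢⇒< b≤a (a≢b ∘ sym) , refl)

only-R0-fixes : ∀ {a b c d} → b ≤ a → c ≤ a → d ≤ b →
  ¬ ((a ≡ b) × (b ≡ c) × (c ≡ d)) → ¬ ((a ≡ c) × (b < a) × (b ≡ d)) →
  ¬ ((a ≡ b) × (c < a) × (c ≡ d)) →
  ¬ ((a ≡ c) × (b ≢ d)) → ¬ ((b ≡ d) × (a ≢ c)) →
  ∀ g → g ⊙ (a , b , c , d) ≡ (a , b , c , d) → g ∈ R0 ∷ []
only-R0-fixes _ _ _ _ _ _ _ _ R0 _ = here refl
only-R0-fixes _ _ _ ¬c1 _ _ _ _ R90  refl = ⊥-elim (¬c1 (refl , refl , refl))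
only-R0-fixes _ _ _ ¬c1 _ _ _ _ R270 refl = ⊥-elim (¬c1 (refl , refl , refl))
only-R0-fixes b≤a _ _ ¬c1 ¬c2 _ _ _ R180 refl = ⊥-elim (balanced-diagonals-excluded b≤a ¬c1 ¬c2)
only-R0-fixes b≤a _ a≤b ¬c1 _ _ _ _ H refl = ⊥-elim (¬c1 (≤-antisym a≤b b≤a , refl , ≤-antisym b≤a a≤b))
only-R0-fixes {a} {_} {c} _ c≤a _ ¬c1 _ ¬c3 _ _ V refl with c ≟ℕ a
... | yes refl = ⊥-elim (¬c1 (refl , refl , refl))
... | no  c≢a  = ⊥-elim (¬c3 (refl , ≤∧≢⇒< c≤a c≢a , refl))
only-R0-fixes {a} {_} {c} b≤a _ _ ¬c1 ¬c2 _ _ ¬c5 D refl with a ≟ℕ c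
... | yes refl = ⊥-elim (balanced-diagonals-excluded b≤a ¬c1 ¬c2)
... | no  a≢c  = ⊥-elim (¬c5 (refl , a≢c))
only-R0-fixes {_} {b} {_} {d} b≤a _ _ ¬c1 ¬c2 _ ¬c4 _ D' refl with b ≟ℕ d
... | yes refl = ⊥-elim (balanced-diagonals-excluded b≤a ¬c1 ¬c2)
... | no  b≢d  = ⊥-elim (¬c4 (refl , b≢d))

corollary4p2 : (k r l1 l2 l3 l4 : ℕ) → 1 ≤ k → 1 ≤ r → r ≤ 4 * (k * k)
    → l1 ≤ k * k → l2 ≤ k * k → l3 ≤ k * k → l4 ≤ k * k
    → l1 + l2 + l3 + l4 ≡ r
    → l1 ≥ l2 → l1 ≥ l3 → l1 ≥ l4 → l2 ≥ l4 → (l1 ≡ l2 → l3 ≥ l4)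
    → let K = Preserves k r (l1 , l2 , l3 , l4)
          c1 = (l1 ≡ l2) × (l2 ≡ l3) × (l3 ≡ l4)
          c2 = (l1 ≡ l3) × (l2 < l1) × (l2 ≡ l4)
          c3 = (l1 ≡ l2) × (l3 < l1) × (l3 ≡ l4)
          c4 = (l1 ≡ l3) × (l2 ≢ l4)
          c5 = (l2 ≡ l4) × (l1 ≢ l3)
      in (c1 → (K ≐ (λ _ → ⊤)) × HasIndex K 1)
       × (c2 → (K ≐ ⟨ D ∷ D' ∷ [] ⟩) × HasIndex K 2)
       × (c3 → (K ≐ ⟨ V ∷ [] ⟩) × HasIndex K 4)
       × (c4 → (K ≐ ⟨ D' ∷ [] ⟩) × HasIndex K 4)
       × (c5 → (K ≐ ⟨ D ∷ [] ⟩) × HasIndex K 4)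
       × (¬ c1 → ¬ c2 → ¬ c3 → ¬ c4 → ¬ c5 → (K ≐ (λ g → g ≡ R0)) × HasIndex K 8)
corollary4p2 k r l1 l2 l3 l4 _ _ _ l1≤ l2≤ l3≤ l4≤ sum≡r l2≤l1 l3≤l1 _ l4≤l2 _ =
  (λ (e12 , e23 , e34) → subgroup-index elements 1
     (K⇔ (stabiliser⇔ elements (λ g _ → ∈-elements g) (All.tabulate λ {g} _ → fixes-constant e12 e23 e34 g)))
     (λ g → mk⇔ (λ _ → ∈-elements g) (λ _ → tt)) refl) ,
  (λ (e13 , l2<l1 , e24) → subgroup-index _ 2 (K⇔ (stabiliser-⟨D,D'⟩ e13 l2<l1 e24))
     (⟨⟩⇔∈ _ _ (one ∷ mul (gen (here refl)) (gen (there (here refl))) ∷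
                gen (here refl) ∷ gen (there (here refl)) ∷ [])) refl) ,
  (λ (e12 , l3<l1 , e34) → subgroup-index _ 4 (K⇔ (stabiliser-⟨V⟩ e12 l3<l1 e34)) (⟨⟩⇔∈ _ _ R0,x∈⟨x⟩) refl) ,
  (λ (e13 , l2≢l4) → subgroup-index _ 4 (K⇔ (stabiliser-⟨D'⟩ e13 l2≢l4)) (⟨⟩⇔∈ _ _ R0,x∈⟨x⟩) refl) ,
  (λ (e24 , l1≢l3) → subgroup-index _ 4 (K⇔ (stabiliser-⟨D⟩ e24 l1≢l3)) (⟨⟩⇔∈ _ _ R0,x∈⟨x⟩) refl) ,
  (λ ¬c1 ¬c2 ¬c3 ¬c4 ¬c5 → subgroup-index (R0 ∷ []) 8
     (K⇔ (stabiliser⇔ _ (only-R0-fixes l2≤l1 l3≤l1 l4≤l2 ¬c1 ¬c2 ¬c3 ¬c4 ¬c5) (refl ∷ [])))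
     (λ g → mk⇔ (λ { refl → here refl }) (λ { (here g≡R0) → g≡R0 })) refl)
  where
  p : ℕ × ℕ × ℕ × ℕ
  p = l1 , l2 , l3 , l4

  K⇔ : ∀ {ks} → (∀ g → (g ⊙ p ≡ p) ⇔ g ∈ ks) → ∀ g → Preserves k r p g ⇔ g ∈ ks
  K⇔ stabiliser g = ⇔.trans (preserves⇔fixes k r p (fillBoard k p , p-board) g) (stabiliser g)
    where
    p-board : InClass k r p (fillBoard k p)
    p-board = inClass-fillBoard k r l1 l2 l3 l4 l1≤ l2≤ l3≤ l4≤ sum≡r

  R0,x∈⟨x⟩ : ∀ {x} → All ⟨ x ∷ [] ⟩ (R0 ∷ x ∷ [])
  R0,x∈⟨x⟩ = one ∷ gen (here refl) ∷ []
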